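{- Let $G$ be a maximal outerplanar graph with at least one separator triangle. Let $\mathcal{H}$ be the set of components of $G_{\triangle}$ that are adjacent to exactly one serpentine path of $G$, let $c'=|\mathcal{H}|$, and let $n_2'$ be the number of serpentine leaves of $G$ that are adjacent to a component in $\mathcal{H}$. Then $Z(G)\ge \left\lfloor \frac{n_2'}{2}\right\rfloor-2c'$.
   Context: A MOP (maximal outerplanar graph) is an outerplanar graph to which no edge can be added preserving outerplanarity; all bounded faces are triangles. A separator triangle is a bounded triangular face none of whose edges lies on the outer face; $G_{\triangle}$ is the subgraph formed by the union of all separator triangles. The weak planar dual $H$ of $G$ (one vertex per bounded face, adjacent when faces share an edge) is a tree. A serpentine leaf is the set of triangles whose corresponding vertices in $H$ form the path joining a leaf of $H$ to (not including) the nearest vertex of $H$ of degree greater than $2$. A serpentine path is a maximal set of triangles whose corresponding vertices in $H$ all have degree $2$ in $H$ and form the path in $H$ between two distinct vertices of degree at least $3$. A serpentine leaf or path is adjacent to a component of $G_{\triangle}$ if one of its triangles shares an edge with a separator triangle of that component. Zero forcing: color a set $S$ blue and the rest white; repeatedly, if $w$ is the only white neighbor of a blue vertex, color $w$ blue; $Z(G)$ is the minimum size of a set $S$ from which all vertices eventually become blue. -}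

module Defs where

open import Level using (Level; _⊔_) renaming (suc to lsuc; zero to lzero)
open import Data.Nat using (ℕ; zero; suc; _+_; _*_; _≤_; _<_; _∸_; _/_)
open import Data.Fin using (Fin; toℕ; fromℕ; inject₁; _≟_)
  renaming (zero to fzero; suc to fsuc)
open import Data.Fin.Subset using (Subset; _∈_; ∣_∣)
open import Data.Bool using (Bool; true; false; T; _∧_; _∨_; not)
open import Data.List using (List; []; _∷_; length; filterᵇ; allFin; concatMap; map)
open import Data.List.Relation.Unary.All using (All)
open import Data.List.Relation.Unary.Any using (Any)
open import Data.List.Relation.Unary.AllPairs using (AllPairs)
open import Data.Product using (Σ; ∃; ∃-syntax; _×_; _,_)
open import Data.Sum using (_⊎_)
open import Relation.Nullary using (¬_)
open import Relation.Nullary.Decidable using (⌊_⌋)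
open import Relation.Binary.PropositionalEquality using (_≡_; _≢_)
open import Relation.Binary.Construct.Closure.ReflexiveTransitive using (Star)
open import Function using (Injective)

-- Convention: the vertices 0,1,…,n-1 are listed in the cyclic order of
-- the outer (Hamiltonian) cycle of an outerplanar embedding, drawn with
-- the vertices in convex position.

Graph : ℕ → Set
Graph n = Fin n → Fin n → Bool

Edge : ∀ {n} → Graph n → Fin n → Fin n → Set
Edge E u v = E u v ≡ true

-- A maximal outerplanar graph, presented with its (convex) outerplanar
-- embedding: a simple graph containing the polygon 0,1,…,n-1 as its
-- outer cycle, whose chords pairwise do not cross, and to which no
-- further chord can be added without a crossing.
record IsMOP {n : ℕ} (E : Graph n) : Set where
  field
    atLeast3     : 3 ≤ n
    irreflexive  : ∀ v → E v v ≡ false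
    symmetric    : ∀ u v → E u v ≡ E v u
    cycleEdge    : ∀ u v → toℕ v ≡ suc (toℕ u) → Edge E u v
    closingEdge  : ∀ u v → toℕ u ≡ 0 → suc (toℕ v) ≡ n → Edge E u v
    nonCrossing  : ∀ a b c d → toℕ a < toℕ b → toℕ b < toℕ c → toℕ c < toℕ d →
                   Edge E a c → E b d ≡ false
    maximal      : ∀ a c → toℕ a < toℕ c → E a c ≡ false →
                   ∃[ x ] ∃[ y ] (Edge E x y ×
                     ((toℕ x < toℕ a × toℕ a < toℕ y × toℕ y < toℕ c)
                      ⊎ (toℕ a < toℕ x × toℕ x < toℕ c × toℕ c < toℕ y)))

Tri : ℕ → Set
Tri n = Fin n × Fin n × Fin n

allTriples : ∀ n → List (Tri n)
allTriples n = concatMap (λ a → concatMap (λ b → map (λ c → (a , b , c)) (allFin n))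
                                             (allFin n)) (allFin n)

ltB : ∀ {n} → Fin n → Fin n → Bool
ltB x y = ⌊ Data.Nat._<?_ (toℕ x) (toℕ y) ⌋
  where import Data.Nat

eqB : ∀ {n} → Fin n → Fin n → Bool
eqB x y = ⌊ x ≟ y ⌋

eqNB : ℕ → ℕ → Bool
eqNB x y = ⌊ Data.Nat._≟_ x y ⌋
  where import Data.Nat

inTriB : ∀ {n} → Fin n → Tri n → Bool
inTriB x (a , b , c) = eqB x a ∨ eqB x b ∨ eqB x c

module _ {n : ℕ} (E : Graph n) where

  -- Bounded faces of the (convex) embedding = triangles a < b < c of G
  -- (each stored once, with increasing vertices).
  isFaceB : Tri n → Bool
  isFaceB (a , b , c) = ltB a b ∧ ltB b c ∧ E a b ∧ E b c ∧ E a c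

  Face : Tri n → Set
  Face t = T (isFaceB t)

  faces : List (Tri n)
  faces = filterᵇ isFaceB (allTriples n)

  -- an edge {x,y} (x < y) lies on the outer face iff it is a side of the polygon
  outerB : Fin n → Fin n → Bool
  outerB x y = eqNB (toℕ y) (suc (toℕ x)) ∨ (eqNB (toℕ x) 0 ∧ eqNB (suc (toℕ y)) n)

  isSepB : Tri n → Bool
  isSepB t@(a , b , c) = isFaceB t ∧ not (outerB a b) ∧ not (outerB b c) ∧ not (outerB a c)

  SepTri : Tri n → Set
  SepTri t = T (isSepB t)

  -- weak planar dual H: faces adjacent iff distinct and sharing an edge
  -- (i.e. sharing two vertices)
  shareEdgeB : Tri n → Tri n → Bool
  shareEdgeB s (a , b , c) =
    (inTriB a s ∧ inTriB b s) ∨ (inTriB b s ∧ inTriB c s) ∨ (inTriB a s ∧ inTriB c s)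

  sameTriB : Tri n → Tri n → Bool
  sameTriB (a , b , c) (a' , b' , c') = eqB a a' ∧ eqB b b' ∧ eqB c c'

  adjHB : Tri n → Tri n → Bool
  adjHB s t = isFaceB s ∧ isFaceB t ∧ not (sameTriB s t) ∧ shareEdgeB s t

  AdjH : Tri n → Tri n → Set
  AdjH s t = T (adjHB s t)

  degH : Tri n → ℕ
  degH t = length (filterᵇ (adjHB t) faces)

  data HWalk : Tri n → Tri n → ℕ → Set where
    here : ∀ {t} → HWalk t t 0
    step : ∀ {s t u m} → AdjH s t → HWalk t u m → HWalk s u (suc m)

  record HPath (m : ℕ) : Set where
    field
      vtx      : Fin (suc m) → Tri n
      isFace   : ∀ i → Face (vtx i)
      adjacent : ∀ (i : Fin m) → AdjH (vtx (inject₁ i)) (vtx (fsuc i))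
      distinct : Injective _≡_ _≡_ vtx

  TriSet : Set₁
  TriSet = Tri n → Set

  -- serpentine leaf: triangles of the path from a leaf ℓ of H to
  -- (not including) the nearest vertex w of H with degree > 2
  SerpentineLeaf : TriSet → Set
  SerpentineLeaf S = ∃[ m ] Σ (HPath m) λ P →
    let open HPath P
        ℓ = vtx fzero
        w = vtx (fromℕ m)
    in degH ℓ ≡ 1 × 2 < degH w ×
       (∀ w' k → Face w' → 2 < degH w' → HWalk ℓ w' k → m ≤ k) ×
       (∀ t → S t → ∃[ i ] vtx (inject₁ i) ≡ t) ×
       (∀ (i : Fin m) → S (vtx (inject₁ i)))

  -- serpentine path: the triangles (all of H-degree 2) strictly between two
  -- distinct vertices u, v of H of degree ≥ 3 on the path joining them
  SerpentinePath : TriSet → Set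
  SerpentinePath S = ∃[ m ] Σ (HPath m) λ P →
    let open HPath P
        u = vtx fzero
        v = vtx (fromℕ m)
    in u ≢ v × 3 ≤ degH u × 3 ≤ degH v ×
       (∀ i → 0 < toℕ i → toℕ i < m → degH (vtx i) ≡ 2) ×
       (∀ t → S t → ∃[ i ] (0 < toℕ i × toℕ i < m × vtx i ≡ t)) ×
       (∀ i → 0 < toℕ i → toℕ i < m → S (vtx i))

  -- G_△ : union of the separator triangles

  VertΔ : Fin n → Set
  VertΔ v = ∃[ t ] (SepTri t × T (inTriB v t))

  EdgeΔ : Fin n → Fin n → Set
  EdgeΔ u v = u ≢ v × ∃[ t ] (SepTri t × T (inTriB u t) × T (inTriB v t))

  VSet : Set₁
  VSet = Fin n → Set

  record IsComponentΔ (C : VSet) : Set where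
    field
      nonempty  : ∃[ v ] C v
      inside    : ∀ v → C v → VertΔ v
      closed    : ∀ u v → C u → EdgeΔ u v → C v
      connected : ∀ u v → C u → C v → Star EdgeΔ u v

  SepTriOf : VSet → Tri n → Set
  SepTriOf C t@(a , b , c) = SepTri t × C a × C b × C c

  AdjacentTo : TriSet → VSet → Set
  AdjacentTo S C = ∃[ s ] ∃[ t ] (S s × SepTriOf C t × AdjH s t)

_≐ₜ_ : ∀ {n} → (Tri n → Set) → (Tri n → Set) → Set
S ≐ₜ S' = ∀ t → (S t → S' t) × (S' t → S t)

_≐ᵥ_ : ∀ {n} → (Fin n → Set) → (Fin n → Set) → Set
C ≐ᵥ C' = ∀ v → (C v → C' v) × (C' v → C v)

module _ {n : ℕ} (E : Graph n) where

  -- components of G_△ adjacent to exactly one serpentine path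
  -- (serpentine paths compared as sets of triangles)
  InH : (Fin n → Set) → Set₁
  InH C = IsComponentΔ E C ×
          ∃[ S ] (SerpentinePath E S × AdjacentTo E S C ×
                  (∀ S' → SerpentinePath E S' → AdjacentTo E S' C → S' ≐ₜ S))

  LeafAdjH : (Tri n → Set) → Set₁
  LeafAdjH S = SerpentineLeaf E S × ∃[ C ] (InH C × AdjacentTo E S C)

-- Cardinality of a (finite) collection of sets, up to extensional equality:
-- "P has exactly k elements" = there is a duplicate-free list of k members
-- of P containing (a copy of) every member of P.

HasCard : {A : Set₁} (_≈_ : A → A → Set) (P : A → Set₁) (k : ℕ) → Set₁
HasCard {A} _≈_ P k = ∃[ xs ] (length xs ≡ k × All P xs ×
                        AllPairs (λ x y → ¬ (x ≈ y)) xs ×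
                        (∀ x → P x → Any (x ≈_) xs))

data Blue {n : ℕ} (E : Graph n) (S : Subset n) : Fin n → Set where
  initial : ∀ {v} → v ∈ S → Blue E S v
  force   : ∀ {u v} → Blue E S u → Edge E u v →
            (∀ w → Edge E u w → w ≢ v → Blue E S w) → Blue E S v

ZeroForcingSet : ∀ {n} → Graph n → Subset n → Set
ZeroForcingSet E S = ∀ v → Blue E S v

-- A leaf face of the weak dual H of a maximal outerplanar graph has two sides on the outer
-- cycle, so the vertex shared by those sides is an ear: it has exactly two neighbours, and
-- they are adjacent.  A serpentine leaf is determined by its leaf face and a leaf face by its
-- ear, so distinct serpentine leaves give distinct ears.  In a zero forcing process from S,
-- distinct vertices outside S have distinct forcers, and an ear outside S never forces (when
-- it turned blue, its other neighbour was already blue).  So the n - ∣S∣ forcers and the ears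
-- outside S are distinct vertices, as are the n - ∣S∣ vertices outside S and the ears in S.
-- Hence there are at most 2∣S∣ ears, and n₂' ≤ 2 Z(G), which is stronger than the claim.
module Submission where

open import Defs
open import Data.Nat using (ℕ; _≤_; _/_; _∸_; _*_)
open import Data.Fin using (Fin)
open import Data.Fin.Subset using (Subset; ∣_∣)
open import Data.Bool using (Bool)
open import Data.Product using (∃-syntax)

open import Data.Nat as ℕ using (zero; suc; _+_; _⊔_; z≤n; s≤s)
import Data.Nat.Properties as ℕ
open import Data.Nat.DivMod using (/-monoˡ-≤; m*n/n≡m)
open import Data.Nat.Induction using (<-wellFounded)
open import Data.Nat.Tactic.RingSolver using (solve-∀)
open import Induction.WellFounded using (Acc; acc)
open import Data.Fin using (toℕ; fromℕ<; fromℕ; inject₁; _≟_) renaming (zero to fzero; suc to fsuc)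
open import Data.Fin.Properties as Finₚ
  using (any?; all?; <-cmp; <-trans; <⇒≢; toℕ-injective; toℕ<n; toℕ-fromℕ<; fromℕ<-toℕ; toℕ-inject₁)
open import Data.Fin.Subset using (inside; outside; _∈_; _∉_; ∁)
open import Data.Fin.Subset.Properties using (_∈?_; x∈∁p⇒x∉p; ∣∁p∣≡n∸∣p∣; ∣p∣≤n)
open import Data.Bool as Bool using (true; false; T; not; _∧_; _∨_)
open import Data.Bool.Properties using (T?; T-≡; T-∨; T-∧)
open import Data.Unit using (tt)
open import Data.Empty using (⊥; ⊥-elim)
open import Data.Vec.Base as Vec using ([]; _∷_)
open import Data.List using (List; []; _∷_; length; map; _++_; allFin; concatMap)
open import Data.List.Properties using (length-map; length-++; length-removeAt′; length-tabulate)
open import Data.List.Relation.Unary.All as All using (All; []; _∷_)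
import Data.List.Relation.Unary.All.Properties as All
open import Data.List.Relation.Unary.Any as Any using (here; there; _─_)
open import Data.List.Relation.Unary.AllPairs as AllPairs using (AllPairs; []; _∷_)
import Data.List.Relation.Unary.AllPairs.Properties as AllPairs
open import Data.List.Relation.Unary.Unique.Propositional using (Unique)
import Data.List.Relation.Unary.Unique.Propositional.Properties as Unique
open import Data.List.Membership.Propositional using () renaming (_∈_ to _∈ₗ_)
open import Data.List.Membership.Propositional.Properties
  using (∈-map⁺; ∈-++⁺ˡ; ∈-++⁺ʳ; ∈-allFin; ∈-concatMap⁺; ∈-filter⁺)
open import Data.List.Relation.Binary.Subset.Propositional using (_⊆_)
open import Data.Product using (_×_; _,_; proj₁; proj₂)
open import Data.Product.Properties using (≡-dec)
open import Data.Sum using (_⊎_; inj₁; inj₂)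
open import Function using (Equivalence; _∘_; id)
open import Relation.Nullary using (¬_; Dec; yes; no; contradiction; ¬?)
open import Relation.Nullary.Decidable using (⌊_⌋; map′; _×-dec_; _→-dec_; toWitness; fromWitness)
open import Relation.Binary using (tri<; tri≈; tri>)
open import Relation.Binary.PropositionalEquality

module _ {a} {A : Set a} where

  ∈-─⁺ : ∀ {x y} {ys : List A} (x∈ys : x ∈ₗ ys) → y ∈ₗ ys → y ≢ x → y ∈ₗ (ys ─ x∈ys)
  ∈-─⁺ (here refl) (here refl)  y≢x = contradiction refl y≢x
  ∈-─⁺ (here refl) (there y∈ys) _   = y∈ys
  ∈-─⁺ (there _)   (here refl)  _   = here refl
  ∈-─⁺ (there x∈ys) (there y∈ys) y≢x = there (∈-─⁺ x∈ys y∈ys y≢x)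

  unique⊆⇒length≤ : ∀ {xs ys : List A} → Unique xs → xs ⊆ ys → length xs ≤ length ys
  unique⊆⇒length≤ {[]}     _              _     = z≤n
  unique⊆⇒length≤ {x ∷ xs} {ys} (x∉xs ∷ !xs) xs⊆ys = begin
    suc (length xs)             ≤⟨ s≤s (unique⊆⇒length≤ !xs xs⊆ys─x) ⟩
    suc (length (ys ─ x∈ys))    ≡⟨ sym (length-removeAt′ ys _) ⟩
    length ys                   ∎
    where
    open ℕ.≤-Reasoning
    x∈ys : x ∈ₗ ys
    x∈ys = xs⊆ys (here refl)
    xs⊆ys─x : xs ⊆ (ys ─ x∈ys)
    xs⊆ys─x y∈xs = ∈-─⁺ x∈ys (xs⊆ys (there y∈xs)) (λ { refl → All.lookup x∉xs y∈xs refl })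

module _ {a b p} {A : Set a} {B : Set b} {P : A → Set p} (f : ∀ {x} → P x → B) where

  length-reduce : ∀ {xs} (pxs : All P xs) → length (All.reduce f pxs) ≡ length xs
  length-reduce []         = refl
  length-reduce (_ ∷ pxs)  = cong suc (length-reduce pxs)

  All-reduce⁺ : ∀ {q} {Q : B → Set q} → (∀ {x} (px : P x) → Q (f px)) →
            ∀ {xs} (pxs : All P xs) → All Q (All.reduce f pxs)
  All-reduce⁺ h []         = []
  All-reduce⁺ h (px ∷ pxs) = h px ∷ All-reduce⁺ h pxs

  AllPairs-reduce⁺ : ∀ {q r} {R : A → A → Set r} {Q : B → B → Set q} →
                     (∀ {x y} (px : P x) (py : P y) → R x y → Q (f px) (f py)) →
                     ∀ {xs} (pxs : All P xs) → AllPairs R xs → AllPairs Q (All.reduce f pxs)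
  AllPairs-reduce⁺ {R = R} {Q} h = go
    where
    first : ∀ {x xs} (px : P x) (pxs : All P xs) → All (R x) xs → All (Q (f px)) (All.reduce f pxs)
    first px []         []         = []
    first px (py ∷ pys) (Rxy ∷ Rxys) = h px py Rxy ∷ first px pys Rxys
    go : ∀ {xs} (pxs : All P xs) → AllPairs R xs → AllPairs Q (All.reduce f pxs)
    go []         []           = []
    go (px ∷ pxs) (Rxs ∷ Rxss) = first px pxs Rxs ∷ go pxs Rxss

∀-eventually⇒eventually-∀ : ∀ {q m} {Q : ℕ → Fin m → Set q} → (∀ {k k′ i} → k ≤ k′ → Q k i → Q k′ i) →
                             (∀ i → ∃[ k ] Q k i) → ∃[ K ] (∀ i → Q K i)
∀-eventually⇒eventually-∀ {m = zero}  mono ev = 0 , λ ()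
∀-eventually⇒eventually-∀ {m = suc m} mono ev with ev fzero | ∀-eventually⇒eventually-∀ mono (ev ∘ fsuc)
... | k , q₀ | K , qs = k ⊔ K , λ { fzero → mono (ℕ.m≤m⊔n k K) q₀ ; (fsuc i) → mono (ℕ.m≤n⊔m k K) (qs i) }

members : ∀ {n} → Subset n → List (Fin n)
members []            = []
members (inside ∷ s)  = fzero ∷ map fsuc (members s)
members (outside ∷ s) = map fsuc (members s)

length-members : ∀ {n} (s : Subset n) → length (members s) ≡ ∣ s ∣
length-members []            = refl
length-members (inside ∷ s)  = cong suc (trans (length-map fsuc (members s)) (length-members s))
length-members (outside ∷ s) = trans (length-map fsuc (members s)) (length-members s)

members-∈ : ∀ {n} (s : Subset n) → All (_∈ s) (members s)
members-∈ []            = []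
members-∈ (inside ∷ s)  = Vec.here ∷ All.map⁺ (All.map Vec.there (members-∈ s))
members-∈ (outside ∷ s) = All.map⁺ (All.map Vec.there (members-∈ s))

members-unique : ∀ {n} (s : Subset n) → Unique (members s)
members-unique []            = []
members-unique (inside ∷ s)  =
  All.map⁺ (All.universal (λ _ ()) (members s)) ∷ Unique.map⁺ Finₚ.suc-injective (members-unique s)
members-unique (outside ∷ s) = Unique.map⁺ Finₚ.suc-injective (members-unique s)

unique⇒length≤n+n : ∀ {n} {zs : List (Fin n × Bool)} → Unique zs → length zs ≤ n + n
unique⇒length≤n+n {n} !zs = ℕ.≤-trans (unique⊆⇒length≤ !zs (λ {z} _ → ∈-both z)) (ℕ.≤-reflexive length-both)
  where
  both : List (Fin n × Bool)
  both = map (_, false) (allFin n) ++ map (_, true) (allFin n)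
  ∈-both : ∀ z → z ∈ₗ both
  ∈-both (x , false) = ∈-++⁺ˡ (∈-map⁺ (_, false) (∈-allFin x))
  ∈-both (x , true)  = ∈-++⁺ʳ (map (_, false) (allFin n)) (∈-map⁺ (_, true) (∈-allFin x))
  length-copy : ∀ b → length (map (_, b) (allFin n)) ≡ n
  length-copy b = trans (length-map _ (allFin n)) (length-tabulate id)
  length-both : length both ≡ n + n
  length-both = trans (length-++ (map (_, false) (allFin n)))
                      (cong₂ _+_ (length-copy false) (length-copy true))

record Ear {n} (E : Graph n) (x : Fin n) : Set where
  field
    left right  : Fin n
    left-right  : Edge E left right
    neighbours  : ∀ w → Edge E x w → w ≡ left ⊎ w ≡ right

module ZeroForcing {n} (E : Graph n) (S : Subset n) where
  open Data.Nat using (_<_)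

  mutual
    blue : ℕ → Fin n → Bool
    blue zero    v = ⌊ v ∈? S ⌋
    blue (suc k) v = blue k v ∨ ⌊ any? (λ u → forces? k u v) ⌋

    record Forces (k : ℕ) (u v : Fin n) : Set where
      pattern
      constructor forces
      field
        forcer-blue : T (blue k u)
        edge        : Edge E u v
        others-blue : ∀ w → Edge E u w → w ≢ v → T (blue k w)

    forces? : ∀ k u v → Dec (Forces k u v)
    forces? k u v = map′ (λ (bu , euv , others) → forces bu euv others)
                         (λ (forces bu euv others) → bu , euv , others)
      (T? (blue k u) ×-dec E u v Bool.≟ true ×-dec
       all? (λ w → E u w Bool.≟ true →-dec ¬? (w ≟ v) →-dec T? (blue k w)))

  ForcesIn : ℕ → Fin n → Fin n → Set
  ForcesIn k u v = Forces k u v × ¬ T (blue k v)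

  blue-mono : ∀ {k k′} v → k ≤ k′ → T (blue k v) → T (blue k′ v)
  blue-mono {k′ = zero}   v z≤n b = b
  blue-mono {k′ = suc k′} v k≤k′ b with ℕ.m≤n⇒m<n∨m≡n k≤k′
  ... | inj₁ k<1+k′ = Equivalence.from T-∨ (inj₁ (blue-mono v (ℕ.≤-pred k<1+k′) b))
  ... | inj₂ refl   = b

  blue-force : ∀ {k u v} → Forces k u v → T (blue (suc k) v)
  blue-force {k} {u} {v} f =
    Equivalence.from (T-∨ {blue k v}) (inj₂ (fromWitness {a? = any? (λ u → forces? k u v)} (u , f)))

  newly-blue : ∀ {k v} → T (blue (suc k) v) → ¬ T (blue k v) → ∃[ u ] Forces k u v
  newly-blue b ¬b with Equivalence.to T-∨ b
  ... | inj₁ b′ = contradiction b′ ¬b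
  ... | inj₂ f  = toWitness f

  Blue⇒blue : ∀ {v} → Blue E S v → ∃[ k ] T (blue k v)
  Blue⇒blue (initial v∈S) = 0 , fromWitness v∈S
  Blue⇒blue (force {u} {v} Bu euv others)
    with Blue⇒blue Bu
       | ∀-eventually⇒eventually-∀ (λ {_} {_} {w} k≤k′ h e w≢v → blue-mono w k≤k′ (h e w≢v)) others-eventually
    where
    others-eventually : ∀ w → ∃[ k ] (Edge E u w → w ≢ v → T (blue k w))
    others-eventually w with E u w Bool.≟ true | w ≟ v
    ... | no ¬euw | _       = 0 , λ euw → contradiction euw ¬euw
    ... | yes _   | yes w≡v = 0 , λ _ w≢v → contradiction w≡v w≢v
    ... | yes euw | no w≢v  = let k , b = Blue⇒blue (others w euw w≢v) in k , λ _ _ → b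
  ... | k , bu | K , bothers =
    suc (k ⊔ K) , blue-force (forces (blue-mono u (ℕ.m≤m⊔n k K) bu) euv
                                     λ w e w≢v → blue-mono w (ℕ.m≤n⊔m k K) (bothers w e w≢v))

  blue⇒forced : ∀ {k v} → T (blue k v) → v ∉ S → ∃[ j ] (j < k × ∃[ u ] ForcesIn j u v)
  blue⇒forced {zero}      b v∉S = contradiction (toWitness b) v∉S
  blue⇒forced {suc k} {v} b v∉S with T? (blue k v)
  ... | yes b′ = let j , j<k , r = blue⇒forced b′ v∉S in j , ℕ.m<n⇒m<1+n j<k , r
  ... | no ¬b  = let u , f = newly-blue b ¬b in k , ℕ.n<1+n k , u , f , ¬b

  forcesIn-functional : ∀ {j j′ u v v′} → ForcesIn j u v → ForcesIn j′ u v′ → v ≡ v′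
  forcesIn-functional {j} {j′} {v = v} {v′} (forces _ euv others , ¬bv) (forces _ euv′ others′ , ¬bv′)
    with v ≟ v′
  ... | yes v≡v′ = v≡v′
  ... | no v≢v′ with ℕ.≤-total j j′
  ...   | inj₁ j≤j′ = contradiction (blue-mono v′ j≤j′ (others v′ euv′ (v≢v′ ∘ sym))) ¬bv′
  ...   | inj₂ j′≤j = contradiction (blue-mono v j′≤j (others′ v euv v≢v′)) ¬bv

  module Chronology (zfs : ZeroForcingSet E S) where

    forcing : ∀ {v} → v ∈ ∁ S → ∃[ j ] ∃[ u ] ForcesIn j u v
    forcing {v} v∈∁S with Blue⇒blue (zfs v)
    ... | k , b with blue⇒forced {k} {v} b (x∈∁p⇒x∉p v∈∁S)
    ... | j , _ , r = j , r

    forcer : ∀ {v} → v ∈ ∁ S → Fin n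
    forcer v∈∁S = proj₁ (proj₂ (forcing v∈∁S))

    forcer-injective : ∀ {v w} (p : v ∈ ∁ S) (q : w ∈ ∁ S) → forcer p ≡ forcer q → v ≡ w
    forcer-injective p q = same-forcer (forcing p) (forcing q)
      where
      same-forcer : ∀ {v w} (r : ∃[ j ] ∃[ u ] ForcesIn j u v) (r′ : ∃[ j ] ∃[ u ] ForcesIn j u w) →
                    proj₁ (proj₂ r) ≡ proj₁ (proj₂ r′) → v ≡ w
      same-forcer (_ , _ , f) (_ , _ , f′) refl = forcesIn-functional f f′

    forcers : List (Fin n)
    forcers = All.reduce forcer (members-∈ (∁ S))

    length-forcers : length forcers ≡ ∣ ∁ S ∣
    length-forcers = trans (length-reduce forcer (members-∈ (∁ S))) (length-members (∁ S))

  module _ (symmetric : ∀ u v → E u v ≡ E v u) (irreflexive : ∀ v → E v v ≡ false) where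

    ear-never-forces : ∀ {x k v} → Ear E x → x ∉ S → ¬ ForcesIn k x v
    ear-never-forces {x} {k} {v} ear x∉S (forces bx exv _ , ¬bv) with blue⇒forced {k} {x} bx x∉S
    ... | j , j<k , u , forces bu eux others , _ = ¬bv (blue-mono v (ℕ.<⇒≤ j<k) v-blue)
      where
      open Ear ear
      adjacent : ∀ {u v} → u ≡ left ⊎ u ≡ right → v ≡ left ⊎ v ≡ right → v ≢ u → Edge E u v
      adjacent (inj₁ refl) (inj₁ refl) v≢u = contradiction refl v≢u
      adjacent (inj₁ refl) (inj₂ refl) _   = left-right
      adjacent (inj₂ refl) (inj₁ refl) _   = trans (symmetric right left) left-right
      adjacent (inj₂ refl) (inj₂ refl) v≢u = contradiction refl v≢u
      v≢x : v ≢ x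
      v≢x refl with trans (sym (irreflexive x)) exv
      ... | ()
      v-blue : T (blue j v)
      v-blue with v ≟ u
      ... | yes refl = bu
      ... | no v≢u   =
        others v (adjacent (neighbours u (trans (symmetric x u) eux)) (neighbours v exv) v≢u) v≢x

    module _ (zfs : ZeroForcingSet E S) where
      open Chronology zfs

      tag : Fin n → Fin n × Bool
      tag x = x , ⌊ x ∈? S ⌋

      -- Two copies of the vertex set: the first holds the forcers and the ears outside S,
      -- the second the vertices outside S and the ears in S.
      tagged : List (Fin n) → List (Fin n × Bool)
      tagged X = map (_, false) forcers ++ map (_, true) (members (∁ S)) ++ map tag X

      length-tagged : ∀ X → length (tagged X) ≡ ∣ ∁ S ∣ + (∣ ∁ S ∣ + length X)
      length-tagged X = begin-equality
        length (tagged X)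
          ≡⟨ length-++ (map (_, false) forcers) ⟩
        length (map (_, false) forcers) + length (map (_, true) (members (∁ S)) ++ map tag X)
          ≡⟨ cong (length (map (_, false) forcers) +_) (length-++ (map (_, true) (members (∁ S)))) ⟩
        length (map (_, false) forcers) + (length (map (_, true) (members (∁ S))) + length (map tag X))
          ≡⟨ cong₂ _+_ (trans (length-map _ forcers) length-forcers)
                       (cong₂ _+_ (trans (length-map _ (members (∁ S))) (length-members (∁ S)))
                                  (length-map tag X)) ⟩
        ∣ ∁ S ∣ + (∣ ∁ S ∣ + length X) ∎
        where open ℕ.≤-Reasoning

      forcer≢ear : ∀ {v x} (p : v ∈ ∁ S) → Ear E x → (forcer p , false) ≢ tag x
      forcer≢ear p ear e with cong proj₁ e | cong proj₂ e
      ... | refl | x∉S = ear-never-forces ear (λ x∈S → subst T (sym x∉S) (fromWitness {a? = _ ∈? S} x∈S))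
                                          (proj₂ (proj₂ (forcing p)))

      outside≢ear : ∀ {v x} → v ∈ ∁ S → (v , true) ≢ tag x
      outside≢ear v∈∁S e with cong proj₁ e | cong proj₂ e
      ... | refl | x∈S = x∈∁p⇒x∉p v∈∁S (toWitness {a? = _ ∈? S} (subst T x∈S tt))

      tagged-unique : ∀ {X} → Unique X → All (Ear E) X → Unique (tagged X)
      tagged-unique {X} !X earsX =
        AllPairs.++⁺ unique-forcers (AllPairs.++⁺ unique-outside unique-ears outside≢ears) forcers≢rest
        where
        unique-forcers : Unique (map (_, false) forcers)
        unique-forcers = AllPairs.map⁺ (AllPairs-reduce⁺ forcer
          (λ p q v≢w e → v≢w (forcer-injective p q (cong proj₁ e))) (members-∈ (∁ S)) (members-unique (∁ S)))
        unique-outside : Unique (map (_, true) (members (∁ S)))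
        unique-outside = AllPairs.map⁺ (AllPairs.map (λ v≢w → v≢w ∘ cong proj₁) (members-unique (∁ S)))
        unique-ears : Unique (map tag X)
        unique-ears = AllPairs.map⁺ (AllPairs.map (λ x≢y → x≢y ∘ cong proj₁) !X)
        outside≢ears : All (λ a → All (a ≢_) (map tag X)) (map (_, true) (members (∁ S)))
        outside≢ears = All.map⁺ (All.map (λ v∈∁S → All.map⁺ (All.universal (λ _ → outside≢ear v∈∁S) X))
                                         (members-∈ (∁ S)))
        forcers≢rest : All (λ a → All (a ≢_) (map (_, true) (members (∁ S)) ++ map tag X))
                           (map (_, false) forcers)
        forcers≢rest = All.map⁺ (All-reduce⁺ forcer
          (λ p → All.++⁺ (All.map⁺ (All.universal (λ _ ()) (members (∁ S))))
                         (All.map⁺ (All.map (forcer≢ear p) earsX)))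
          (members-∈ (∁ S)))

      ears≤2∣S∣ : ∀ {X} → Unique X → All (Ear E) X → length X ≤ 2 * ∣ S ∣
      ears≤2∣S∣ {X} !X earsX = ℕ.+-cancelˡ-≤ (o + o) (length X) (2 * ∣ S ∣) (begin
        (o + o) + length X          ≡⟨ ℕ.+-assoc o o (length X) ⟩
        o + (o + length X)          ≡⟨ length-tagged X ⟨
        length (tagged X)           ≤⟨ unique⇒length≤n+n (tagged-unique !X earsX) ⟩
        n + n                       ≡⟨ cong₂ _+_ o+∣S∣≡n o+∣S∣≡n ⟨
        (o + ∣ S ∣) + (o + ∣ S ∣)   ≡⟨ regroup o ∣ S ∣ ⟩
        (o + o) + 2 * ∣ S ∣         ∎)
        where
        open ℕ.≤-Reasoning
        o : ℕ
        o = ∣ ∁ S ∣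
        o+∣S∣≡n : o + ∣ S ∣ ≡ n
        o+∣S∣≡n = trans (cong (_+ ∣ S ∣) (∣∁p∣≡n∸∣p∣ S)) (ℕ.m∸n+n≡m (∣p∣≤n S))
        regroup : ∀ o s → (o + s) + (o + s) ≡ (o + o) + 2 * s
        regroup = solve-∀

∧⁵-elim : ∀ p q r s t → T (p ∧ q ∧ r ∧ s ∧ t) → T p × T q × T r × T s × T t
∧⁵-elim true true true true true _ = _ , _ , _ , _ , _

∧⁵-intro : ∀ p q r s t → T p → T q → T r → T s → T t → T (p ∧ q ∧ r ∧ s ∧ t)
∧⁵-intro true true true true true _ _ _ _ _ = _

module WeakDual {n} (E : Graph n) where
  open Data.Fin using (_<_)

  face-sides : ∀ {a b c} → Face E (a , b , c) → a < b × b < c × Edge E a b × Edge E b c × Edge E a c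
  face-sides {a} {b} {c} f with ∧⁵-elim (ltB a b) (ltB b c) (E a b) (E b c) (E a c) f
  ... | a<b , b<c , eab , ebc , eac =
    toWitness a<b , toWitness b<c , Equivalence.to T-≡ eab , Equivalence.to T-≡ ebc , Equivalence.to T-≡ eac

  face-intro : ∀ {a b c} → a < b → b < c → Edge E a b → Edge E b c → Edge E a c → Face E (a , b , c)
  face-intro {a} {b} {c} a<b b<c eab ebc eac = ∧⁵-intro (ltB a b) (ltB b c) (E a b) (E b c) (E a c)
    (fromWitness a<b) (fromWitness b<c)
    (Equivalence.from T-≡ eab) (Equivalence.from T-≡ ebc) (Equivalence.from T-≡ eac)

  _∈ᵗ_ : Fin n → Tri n → Set
  x ∈ᵗ (a , b , c) = x ≡ a ⊎ x ≡ b ⊎ x ≡ c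

  private
    eqB-refl : ∀ x → T (eqB {n} x x)
    eqB-refl x = fromWitness {a? = x Finₚ.≟ x} refl

  ∈ᵗ⇒inTriB : ∀ {x} t → x ∈ᵗ t → T (inTriB x t)
  ∈ᵗ⇒inTriB {x} (a , b , c) (inj₁ refl)        = Equivalence.from (T-∨ {eqB x x}) (inj₁ (eqB-refl x))
  ∈ᵗ⇒inTriB {x} (a , b , c) (inj₂ (inj₁ refl)) =
    Equivalence.from (T-∨ {eqB x a}) (inj₂ (Equivalence.from (T-∨ {eqB x x}) (inj₁ (eqB-refl x))))
  ∈ᵗ⇒inTriB {x} (a , b , c) (inj₂ (inj₂ refl)) =
    Equivalence.from (T-∨ {eqB x a}) (inj₂ (Equivalence.from (T-∨ {eqB x b}) (inj₂ (eqB-refl x))))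

  inTriB⇒∈ᵗ : ∀ {x} t → T (inTriB x t) → x ∈ᵗ t
  inTriB⇒∈ᵗ {x} (a , b , c) x∈t with Equivalence.to (T-∨ {eqB x a}) x∈t
  ... | inj₁ x≡a = inj₁ (toWitness x≡a)
  ... | inj₂ x∈bc with Equivalence.to (T-∨ {eqB x b}) x∈bc
  ...   | inj₁ x≡b = inj₂ (inj₁ (toWitness x≡b))
  ...   | inj₂ x≡c = inj₂ (inj₂ (toWitness x≡c))

  SharesSide : Tri n → Tri n → Set
  SharesSide s t = ∃[ u ] ∃[ v ] (u ≢ v × u ∈ᵗ s × v ∈ᵗ s × u ∈ᵗ t × v ∈ᵗ t)

  shares-side-sym : ∀ {s t} → SharesSide s t → SharesSide t s
  shares-side-sym (u , v , u≢v , u∈s , v∈s , u∈t , v∈t) = u , v , u≢v , u∈t , v∈t , u∈s , v∈s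

  private
    both-in : ∀ {s u v t} → T (inTriB u s ∧ inTriB v s) → u ∈ᵗ t → v ∈ᵗ t →
              u ∈ᵗ s × v ∈ᵗ s × u ∈ᵗ t × v ∈ᵗ t
    both-in {s} {u} uv∈s u∈t v∈t with Equivalence.to (T-∧ {inTriB u s}) uv∈s
    ... | u∈s , v∈s = inTriB⇒∈ᵗ s u∈s , inTriB⇒∈ᵗ s v∈s , u∈t , v∈t

  shareEdgeB⇒SharesSide : ∀ {s a b c} → Face E (a , b , c) → T (shareEdgeB E s (a , b , c)) →
                          SharesSide s (a , b , c)
  shareEdgeB⇒SharesSide {s} {a} {b} {c} f sh with face-sides f
  ... | a<b , b<c , _ with Equivalence.to (T-∨ {inTriB a s ∧ inTriB b s}) sh
  ... | inj₁ ab = a , b , <⇒≢ a<b , both-in ab (inj₁ refl) (inj₂ (inj₁ refl))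
  ... | inj₂ sh′ with Equivalence.to (T-∨ {inTriB b s ∧ inTriB c s}) sh′
  ...   | inj₁ bc = b , c , <⇒≢ b<c , both-in bc (inj₂ (inj₁ refl)) (inj₂ (inj₂ refl))
  ...   | inj₂ ac = a , c , <⇒≢ (Finₚ.<-trans a<b b<c) , both-in ac (inj₁ refl) (inj₂ (inj₂ refl))

  private
    both-inTriB : ∀ {s u v} → u ∈ᵗ s → v ∈ᵗ s → T (inTriB u s ∧ inTriB v s)
    both-inTriB {s} {u} u∈s v∈s = Equivalence.from (T-∧ {inTriB u s}) (∈ᵗ⇒inTriB s u∈s , ∈ᵗ⇒inTriB s v∈s)

    share-ab : ∀ {s} a b c → a ∈ᵗ s → b ∈ᵗ s → T (shareEdgeB E s (a , b , c))
    share-ab {s} a b c a∈s b∈s = Equivalence.from (T-∨ {inTriB a s ∧ inTriB b s}) (inj₁ (both-inTriB a∈s b∈s))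

    share-bc : ∀ {s} a b c → b ∈ᵗ s → c ∈ᵗ s → T (shareEdgeB E s (a , b , c))
    share-bc {s} a b c b∈s c∈s = Equivalence.from (T-∨ {inTriB a s ∧ inTriB b s})
      (inj₂ (Equivalence.from (T-∨ {inTriB b s ∧ inTriB c s}) (inj₁ (both-inTriB b∈s c∈s))))

    share-ac : ∀ {s} a b c → a ∈ᵗ s → c ∈ᵗ s → T (shareEdgeB E s (a , b , c))
    share-ac {s} a b c a∈s c∈s = Equivalence.from (T-∨ {inTriB a s ∧ inTriB b s})
      (inj₂ (Equivalence.from (T-∨ {inTriB b s ∧ inTriB c s}) (inj₂ (both-inTriB a∈s c∈s))))

  SharesSide⇒shareEdgeB : ∀ {s} t → SharesSide s t → T (shareEdgeB E s t)
  SharesSide⇒shareEdgeB (a , b , c) (u , v , u≢v , u∈s , v∈s , u∈t , v∈t) with u∈t | v∈t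
  ... | inj₁ refl        | inj₁ refl        = contradiction refl u≢v
  ... | inj₁ refl        | inj₂ (inj₁ refl) = share-ab a b c u∈s v∈s
  ... | inj₁ refl        | inj₂ (inj₂ refl) = share-ac a b c u∈s v∈s
  ... | inj₂ (inj₁ refl) | inj₁ refl        = share-ab a b c v∈s u∈s
  ... | inj₂ (inj₁ refl) | inj₂ (inj₁ refl) = contradiction refl u≢v
  ... | inj₂ (inj₁ refl) | inj₂ (inj₂ refl) = share-bc a b c u∈s v∈s
  ... | inj₂ (inj₂ refl) | inj₁ refl        = share-ac a b c v∈s u∈s
  ... | inj₂ (inj₂ refl) | inj₂ (inj₁ refl) = share-bc a b c v∈s u∈s
  ... | inj₂ (inj₂ refl) | inj₂ (inj₂ refl) = contradiction refl u≢v

  sameTriB⇒≡ : ∀ s t → T (sameTriB E s t) → s ≡ t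
  sameTriB⇒≡ (a , b , c) (a′ , b′ , c′) same with Equivalence.to (T-∧ {eqB a a′}) same
  ... | a≡a′ , same′ with Equivalence.to (T-∧ {eqB b b′}) same′
  ...   | b≡b′ , c≡c′ = toℕ-injective³ (toWitness a≡a′) (toWitness b≡b′) (toWitness c≡c′)
    where
    toℕ-injective³ : ∀ {x x′ y y′ z z′ : Fin n} → x ≡ x′ → y ≡ y′ → z ≡ z′ → (x , y , z) ≡ (x′ , y′ , z′)
    toℕ-injective³ refl refl refl = refl

  not-sameTriB : ∀ {s t} → s ≢ t → T (not (sameTriB E s t))
  not-sameTriB {s} {t} s≢t with sameTriB E s t in same
  ... | true  = contradiction (sameTriB⇒≡ s t (subst T (sym same) tt)) s≢t
  ... | false = tt

  sameTriB-refl : ∀ s → T (sameTriB E s s)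
  sameTriB-refl (a , b , c) = Equivalence.from (T-∧ {eqB a a})
    (eqB-refl a , Equivalence.from (T-∧ {eqB b b}) (eqB-refl b , eqB-refl c))

  adjacent-intro : ∀ {s t} → Face E s → Face E t → s ≢ t → SharesSide s t → AdjH E s t
  adjacent-intro {s} {t} fs ft s≢t sh = Equivalence.from (T-∧ {isFaceB E s}) (fs ,
    Equivalence.from (T-∧ {isFaceB E t}) (ft ,
    Equivalence.from (T-∧ {not (sameTriB E s t)}) (not-sameTriB s≢t , SharesSide⇒shareEdgeB t sh)))

  adjacent-elim : ∀ {s t} → AdjH E s t → Face E s × Face E t × s ≢ t × SharesSide s t
  adjacent-elim {s} {t@(a , b , c)} adj with Equivalence.to (T-∧ {isFaceB E s}) adj
  ... | fs , adj′ with Equivalence.to (T-∧ {isFaceB E t}) adj′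
  ...   | ft , adj″ with Equivalence.to (T-∧ {not (sameTriB E s t)}) adj″
  ...     | s≢t , sh =
    fs , ft , (λ { refl → subst T (not-true (sameTriB-refl s)) s≢t }) , shareEdgeB⇒SharesSide ft sh
    where
    not-true : ∀ {x} → T x → not x ≡ false
    not-true {true} _ = refl

  adjacent-sym : ∀ {s t} → AdjH E s t → AdjH E t s
  adjacent-sym {s} {t} adj with adjacent-elim adj
  ... | fs , ft , s≢t , sh = adjacent-intro {t} {s} ft fs (s≢t ∘ sym) (shares-side-sym sh)

  ∈-allTriples : ∀ t → t ∈ₗ allTriples n
  ∈-allTriples (a , b , c) =
    ∈-concatMap⁺′ (∈-allFin a) (∈-concatMap⁺′ (∈-allFin b) (∈-map⁺ (λ c → a , b , c) (∈-allFin c)))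
    where
    ∈-concatMap⁺′ : ∀ {A B : Set} {f : A → List B} {x y xs} → x ∈ₗ xs → y ∈ₗ f x → y ∈ₗ concatMap f xs
    ∈-concatMap⁺′ {f = f} x∈xs y∈fx = ∈-concatMap⁺ f (Any.map (λ { refl → y∈fx }) x∈xs)

  ∈-faces : ∀ {t} → Face E t → t ∈ₗ faces E
  ∈-faces {t} = ∈-filter⁺ (T? ∘ isFaceB E) (∈-allTriples t)

  length≤degH : ∀ {s ts} → Unique ts → All (AdjH E s) ts → length ts ≤ degH E s
  length≤degH {s} !ts adj = unique⊆⇒length≤ !ts λ {t} t∈ts →
    let s~t = All.lookup adj t∈ts
    in ∈-filter⁺ (T? ∘ adjHB E s) (∈-faces {t} (proj₁ (proj₂ (adjacent-elim {s} {t} s~t)))) s~t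

  _≟ᵗ_ : (s t : Tri n) → Dec (s ≡ t)
  _≟ᵗ_ = ≡-dec Finₚ._≟_ (≡-dec Finₚ._≟_ Finₚ._≟_)

  leaf-neighbour-unique : ∀ {ℓ t t′} → degH E ℓ ≡ 1 → AdjH E ℓ t → AdjH E ℓ t′ → t ≡ t′
  leaf-neighbour-unique {ℓ} {t} {t′} deg1 ℓ~t ℓ~t′ with t ≟ᵗ t′
  ... | yes t≡t′ = t≡t′
  ... | no t≢t′ with subst (2 ℕ.≤_) deg1 (length≤degH {ℓ} ((t≢t′ ∷ []) ∷ [] ∷ []) (ℓ~t ∷ ℓ~t′ ∷ []))
  ...   | ℕ.s≤s ()

  degree≤2-neighbour-unique : ∀ {s r t t′} → degH E s ≤ 2 → AdjH E s r → AdjH E s t → AdjH E s t′ →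
                              r ≢ t → r ≢ t′ → t ≡ t′
  degree≤2-neighbour-unique {s} {r} {t} {t′} deg≤2 s~r s~t s~t′ r≢t r≢t′ with t ≟ᵗ t′
  ... | yes t≡t′ = t≡t′
  ... | no t≢t′ = contradiction
    (length≤degH {s} ((r≢t ∷ r≢t′ ∷ []) ∷ (t≢t′ ∷ []) ∷ [] ∷ []) (s~r ∷ s~t ∷ s~t′ ∷ [])) (ℕ.<⇒≱ (s≤s deg≤2))

module Outerplanar {n} {E : Graph n} (mop : IsMOP E) where
  open Data.Fin using (_<_)
  open IsMOP mop

  edge-sym : ∀ {u v} → Edge E u v → Edge E v u
  edge-sym {u} {v} e = trans (symmetric v u) e

  no-loop : ∀ {v} → ¬ Edge E v v
  no-loop {v} e with trans (sym e) (irreflexive v)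
  ... | ()

  no-crossing : ∀ {a b c d} → a < b → b < c → c < d → Edge E a c → ¬ Edge E b d
  no-crossing {a} {b} {c} {d} a<b b<c c<d eac ebd with trans (sym ebd) (nonCrossing a b c d a<b b<c c<d eac)
  ... | ()

  -- If d–y is not an edge, maximality gives a chord crossing it; it cannot cross x–d or x–y,
  -- so it is x–q with d < q < y, and the search continues from q.  The next two lemmas are alike.
  inner-apex-from : ∀ {x y} d → x < d → d < y → Edge E x d → Edge E x y → Acc ℕ._<_ (toℕ y ∸ toℕ d) →
                    ∃[ d′ ] (x < d′ × d′ < y × Edge E x d′ × Edge E d′ y)
  inner-apex-from {x} {y} d x<d d<y exd exy (acc rec) with E d y in edy | toℕ y ℕ.≟ suc (toℕ d)
  ... | true  | _         = d , x<d , d<y , exd , edy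
  ... | false | yes y≡1+d = d , x<d , d<y , exd , cycleEdge d y y≡1+d
  ... | false | no _ with maximal d y d<y edy
  ...   | p , q , epq , inj₂ (d<p , p<y , y<q) = contradiction epq (no-crossing (<-trans x<d d<p) p<y y<q exy)
  ...   | p , q , epq , inj₁ (p<d , d<q , q<y) with <-cmp p x
  ...     | tri< p<x _ _ = contradiction exy (no-crossing p<x (<-trans x<d d<q) q<y epq)
  ...     | tri> _ _ x<p = contradiction epq (no-crossing x<p p<d d<q exd)
  ...     | tri≈ _ refl _ =
    inner-apex-from q (<-trans x<d d<q) q<y epq exy (rec (ℕ.∸-monoʳ-< d<q (ℕ.<⇒≤ q<y)))

  inner-apex : ∀ {x y} → x < y → toℕ y ≢ suc (toℕ x) → Edge E x y →
               ∃[ d ] (x < d × d < y × Edge E x d × Edge E d y)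
  inner-apex {x} {y} x<y y≢1+x exy =
    inner-apex-from x⁺ x<x⁺ x⁺<y (cycleEdge x x⁺ toℕ-x⁺) exy (<-wellFounded _)
    where
    x⁺ : Fin n
    x⁺ = fromℕ< (ℕ.<-≤-trans (s≤s x<y) (toℕ<n y))
    toℕ-x⁺ : toℕ x⁺ ≡ suc (toℕ x)
    toℕ-x⁺ = toℕ-fromℕ< _
    x<x⁺ : x < x⁺
    x<x⁺ = ℕ.≤-reflexive (sym toℕ-x⁺)
    x⁺<y : x⁺ < y
    x⁺<y = subst (ℕ._< toℕ y) (sym toℕ-x⁺) (ℕ.≤∧≢⇒< x<y (λ 1+x≡y → y≢1+x (sym 1+x≡y)))

  apex-above : ∀ {a c} e → a < c → c < e → Edge E a c → Edge E a e → Acc ℕ._<_ (toℕ e ∸ toℕ c) →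
               ∃[ d ] (c < d × Edge E a d × Edge E d c)
  apex-above {a} {c} e a<c c<e eac eae (acc rec) with E c e in ece | toℕ e ℕ.≟ suc (toℕ c)
  ... | true  | _         = e , c<e , eae , edge-sym ece
  ... | false | yes e≡1+c = e , c<e , eae , edge-sym (cycleEdge c e e≡1+c)
  ... | false | no _ with maximal c e c<e ece
  ...   | p , q , epq , inj₂ (c<p , p<e , e<q) = contradiction epq (no-crossing (<-trans a<c c<p) p<e e<q eae)
  ...   | p , q , epq , inj₁ (p<c , c<q , q<e) with <-cmp p a
  ...     | tri< p<a _ _ = contradiction eae (no-crossing p<a (<-trans a<c c<q) q<e epq)
  ...     | tri> _ _ a<p = contradiction epq (no-crossing a<p p<c c<q eac)
  ...     | tri≈ _ refl _ = apex-above q a<c c<q eac epq (rec (ℕ.∸-monoˡ-< q<e (ℕ.<⇒≤ c<q)))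

  apex-below : ∀ {a c} e → e < a → a < c → Edge E a e → Edge E a c → (∀ q → c < q → ¬ Edge E a q) →
               Acc ℕ._<_ (toℕ e) → ∃[ d ] (d < a × Edge E a d × Edge E d c)
  apex-below {a} {c} e e<a a<c eae eac nothing-above (acc rec) with E e c in eec
  ... | true  = e , e<a , eae , eec
  ... | false with maximal e c (<-trans e<a a<c) eec
  ...   | p , q , epq , inj₂ (e<p , p<c , c<q) with <-cmp p a
  ...     | tri≈ _ refl _ = contradiction epq (nothing-above q c<q)
  ...     | tri< p<a _ _  = contradiction epq (no-crossing e<p p<a (<-trans a<c c<q) (edge-sym eae))
  ...     | tri> _ _ a<p  = contradiction epq (no-crossing a<p p<c c<q eac)
  apex-below {a} {c} e e<a a<c eae eac nothing-above (acc rec)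
      | false | p , q , epq , inj₁ (p<e , e<q , q<c) with <-cmp q a
  ...     | tri≈ _ refl _ = apex-below p (<-trans p<e e<a) a<c (edge-sym epq) eac nothing-above (rec p<e)
  ...     | tri< q<a _ _  = contradiction (edge-sym eae) (no-crossing p<e e<q q<a epq)
  ...     | tri> _ _ a<q  = contradiction eac (no-crossing (<-trans p<e e<a) a<q q<c epq)

  -- Without a neighbour of a beyond c, search below a starting from its cycle predecessor;
  -- a = 0 is impossible then, as the closing edge would join a to n - 1 > c.
  outer-apex : ∀ {a c} → a < c → ¬ (toℕ a ≡ 0 × suc (toℕ c) ≡ n) → Edge E a c →
               ∃[ d ] ((c < d ⊎ d < a) × Edge E a d × Edge E d c)
  outer-apex {a} {c} a<c not-closing eac with any? (λ e → c Finₚ.<? e ×-dec E a e Bool.≟ true)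
  ... | yes (e , c<e , eae) = let d , c<d , ead , edc = apex-above e a<c c<e eac eae (<-wellFounded _)
                              in d , inj₁ c<d , ead , edc
  ... | no ¬above = below (toℕ a) refl
    where
    below : ∀ m → toℕ a ≡ m → ∃[ d ] ((c < d ⊎ d < a) × Edge E a d × Edge E d c)
    below zero toℕa = contradiction (last , c<last , closingEdge a last toℕa suc-last) ¬above
      where
      1≤n : 1 ℕ.≤ n
      1≤n = ℕ.<-≤-trans (s≤s z≤n) (toℕ<n a)
      last : Fin n
      last = fromℕ< (ℕ.∸-monoʳ-< (s≤s z≤n) 1≤n)
      suc-last : suc (toℕ last) ≡ n
      suc-last = trans (cong suc (toℕ-fromℕ< _)) (trans (ℕ.+-comm 1 (n ∸ 1)) (ℕ.m∸n+n≡m 1≤n))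
      c<last : c < last
      c<last = ℕ.≤∧≢⇒< (ℕ.≤-pred (subst (suc (toℕ c) ℕ.≤_) (sym suc-last) (toℕ<n c)))
                       (λ c≡last → not-closing (toℕa , trans (cong suc c≡last) suc-last))
    below (suc k) toℕa =
      let d , d<a , ead , edc = apex-below a⁻ a⁻<a a<c (edge-sym (cycleEdge a⁻ a toℕa⁻)) eac
                                           (λ q c<q eaq → ¬above (q , c<q , eaq)) (<-wellFounded _)
      in d , inj₂ d<a , ead , edc
      where
      k<n : k ℕ.< n
      k<n = ℕ.<-trans (ℕ.n<1+n k) (subst (ℕ._< n) toℕa (toℕ<n a))
      a⁻ : Fin n
      a⁻ = fromℕ< k<n
      toℕa⁻ : toℕ a ≡ suc (toℕ a⁻)
      toℕa⁻ = trans toℕa (cong suc (sym (toℕ-fromℕ< k<n)))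
      a⁻<a : a⁻ < a
      a⁻<a = ℕ.≤-reflexive (sym toℕa⁻)


module LeafFaces {n} {E : Graph n} (mop : IsMOP E) where
  open Data.Fin using (_<_)
  open Outerplanar mop
  open WeakDual E

  -- The faces with two sides on the outer cycle, and the vertex x common to those two sides.
  data EarTip : Tri n → Fin n → Set where
    middle : ∀ {a b c} → toℕ b ≡ suc (toℕ a) → toℕ c ≡ suc (toℕ b) → EarTip (a , b , c) b
    first  : ∀ {a b c} → toℕ a ≡ 0 → toℕ b ≡ 1 → suc (toℕ c) ≡ n → EarTip (a , b , c) a
    last   : ∀ {a b c} → toℕ a ≡ 0 → toℕ c ≡ suc (toℕ b) → suc (toℕ c) ≡ n → EarTip (a , b , c) c

  private
    toℕ-injective³ : ∀ {a b c a′ b′ c′ : Fin n} → toℕ a ≡ toℕ a′ → toℕ b ≡ toℕ b′ → toℕ c ≡ toℕ c′ →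
            (a , b , c) ≡ (a′ , b′ , c′)
    toℕ-injective³ p q r = cong₂ _,_ (toℕ-injective p) (cong₂ _,_ (toℕ-injective q) (toℕ-injective r))

  EarTip-injective : ∀ {ℓ ℓ′ x} → EarTip ℓ x → EarTip ℓ′ x → ℓ ≡ ℓ′
  EarTip-injective (middle b≡1+a c≡1+b) (middle b≡1+a′ c≡1+b′) =
    toℕ-injective³ (ℕ.suc-injective (trans (sym b≡1+a) b≡1+a′)) refl (trans c≡1+b (sym c≡1+b′))
  EarTip-injective (first a≡0 b≡1 1+c≡n) (first a≡0′ b≡1′ 1+c≡n′) =
    toℕ-injective³ refl (trans b≡1 (sym b≡1′)) (ℕ.suc-injective (trans 1+c≡n (sym 1+c≡n′)))
  EarTip-injective (last a≡0 c≡1+b 1+c≡n) (last a≡0′ c≡1+b′ 1+c≡n′) =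
    toℕ-injective³ (trans a≡0 (sym a≡0′)) (ℕ.suc-injective (trans (sym c≡1+b) c≡1+b′)) refl
  EarTip-injective (middle b≡1+a _) (first a≡0 _ _) with trans (sym b≡1+a) a≡0
  ... | ()
  EarTip-injective (first a≡0 _ _) (middle b≡1+a _) with trans (sym b≡1+a) a≡0
  ... | ()
  EarTip-injective (middle {c = c} _ c≡1+b) (last _ _ 1+b≡n) =
    contradiction (toℕ<n c) (ℕ.<-irrefl (trans c≡1+b 1+b≡n))
  EarTip-injective (last _ _ 1+b≡n) (middle {c = c} _ c≡1+b) =
    contradiction (toℕ<n c) (ℕ.<-irrefl (trans c≡1+b 1+b≡n))
  EarTip-injective (first a≡0 _ _) (last _ c≡1+b _) with trans (sym a≡0) c≡1+b
  ... | ()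
  EarTip-injective (last _ c≡1+b _) (first a≡0 _ _) with trans (sym a≡0) c≡1+b
  ... | ()

  module _ {a b c} (f : Face E (a , b , c)) where
    private
      ℓ : Tri n
      ℓ = (a , b , c)
      sides : a < b × b < c × Edge E a b × Edge E b c × Edge E a c
      sides = face-sides {a} {b} {c} f
      a<b : a < b
      a<b = proj₁ sides
      b<c : b < c
      b<c = proj₁ (proj₂ sides)
      a<c : a < c
      a<c = ℕ.<-trans a<b b<c
      eab : Edge E a b
      eab = proj₁ (proj₂ (proj₂ sides))
      ebc : Edge E b c
      ebc = proj₁ (proj₂ (proj₂ (proj₂ sides)))
      eac : Edge E a c
      eac = proj₂ (proj₂ (proj₂ (proj₂ sides)))

      across : ∀ t {u v} → Face E t → ℓ ≢ t → u ≢ v → u ∈ᵗ ℓ → v ∈ᵗ ℓ → u ∈ᵗ t → v ∈ᵗ t → AdjH E ℓ t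
      across t ft ℓ≢t u≢v u∈ℓ v∈ℓ u∈t v∈t =
        adjacent-intro {ℓ} {t} f ft ℓ≢t (_ , _ , u≢v , u∈ℓ , v∈ℓ , u∈t , v∈t)

    middle-neighbours : toℕ b ≡ suc (toℕ a) → toℕ c ≡ suc (toℕ b) → ∀ w → Edge E b w → w ≡ a ⊎ w ≡ c
    middle-neighbours b≡1+a c≡1+b w ebw with <-cmp w a
    ... | tri< w<a _ _  = contradiction eac (no-crossing w<a a<b b<c (edge-sym ebw))
    ... | tri≈ _ refl _ = inj₁ refl
    ... | tri> _ _ a<w with <-cmp w c
    ...   | tri≈ _ refl _ = inj₂ refl
    ...   | tri> _ _ c<w  = contradiction ebw (no-crossing a<b b<c c<w eac)
    ...   | tri< w<c _ _  = contradiction ebw (subst (λ v → ¬ Edge E b v) (toℕ-injective b≡w) no-loop)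
      where
      b≡w : toℕ b ≡ toℕ w
      b≡w = ℕ.≤-antisym (subst (ℕ._≤ toℕ w) (sym b≡1+a) a<w) (ℕ.≤-pred (subst (suc (toℕ w) ℕ.≤_) c≡1+b w<c))

    first-neighbours : toℕ a ≡ 0 → toℕ b ≡ 1 → suc (toℕ c) ≡ n → ∀ w → Edge E a w → w ≡ b ⊎ w ≡ c
    first-neighbours a≡0 b≡1 1+c≡n w eaw with <-cmp w b
    ... | tri< w<b _ _  = contradiction eaw (subst (λ v → ¬ Edge E a v) (toℕ-injective a≡w) no-loop)
      where
      a≡w : toℕ a ≡ toℕ w
      a≡w = trans a≡0 (sym (ℕ.n<1⇒n≡0 (subst (toℕ w ℕ.<_) b≡1 w<b)))
    ... | tri≈ _ refl _ = inj₁ refl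
    ... | tri> _ _ b<w with <-cmp w c
    ...   | tri≈ _ refl _ = inj₂ refl
    ...   | tri< w<c _ _  = contradiction ebc (no-crossing a<b b<w w<c eaw)
    ...   | tri> _ _ c<w  = contradiction (subst (ℕ._≤ toℕ w) 1+c≡n c<w) (ℕ.<⇒≱ (toℕ<n w))

    last-neighbours : toℕ a ≡ 0 → toℕ c ≡ suc (toℕ b) → suc (toℕ c) ≡ n → ∀ w → Edge E c w → w ≡ a ⊎ w ≡ b
    last-neighbours a≡0 c≡1+b 1+c≡n w ecw with <-cmp w a
    ... | tri< w<a _ _  = contradiction (subst (toℕ w ℕ.<_) a≡0 w<a) ℕ.n≮0
    ... | tri≈ _ refl _ = inj₁ refl
    ... | tri> _ _ a<w with <-cmp w b
    ...   | tri≈ _ refl _ = inj₂ refl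
    ...   | tri< w<b _ _  = contradiction (edge-sym ecw) (no-crossing a<w w<b b<c eab)
    ...   | tri> _ _ b<w with <-cmp w c
    ...     | tri≈ _ refl _ = contradiction ecw no-loop
    ...     | tri< w<c _ _  = contradiction (ℕ.≤-pred (subst (suc (toℕ w) ℕ.≤_) c≡1+b w<c)) (ℕ.<⇒≱ b<w)
    ...     | tri> _ _ c<w  = contradiction (subst (ℕ._≤ toℕ w) 1+c≡n c<w) (ℕ.<⇒≱ (toℕ<n w))

    EarTip⇒Ear : ∀ {x} → EarTip ℓ x → Ear E x
    EarTip⇒Ear (middle b≡1+a c≡1+b) =
      record { left = a ; right = c ; left-right = eac ; neighbours = middle-neighbours b≡1+a c≡1+b }
    EarTip⇒Ear (first a≡0 b≡1 1+c≡n) =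
      record { left = b ; right = c ; left-right = ebc ; neighbours = first-neighbours a≡0 b≡1 1+c≡n }
    EarTip⇒Ear (last a≡0 c≡1+b 1+c≡n) =
      record { left = a ; right = b ; left-right = eab ; neighbours = last-neighbours a≡0 c≡1+b 1+c≡n }

    neighbour-across-ab : toℕ b ≢ suc (toℕ a) → ∃[ d ] (d < b × AdjH E ℓ (a , d , b))
    neighbour-across-ab b≢1+a with inner-apex {a} {b} a<b b≢1+a eab
    ... | d , a<d , d<b , ead , edb =
      d , d<b , across (a , d , b) (face-intro {a} {d} {b} a<d d<b ead edb eab)
                       (λ e → <⇒≢ d<b (sym (cong (proj₁ ∘ proj₂) e))) (<⇒≢ a<b)
                       (inj₁ refl) (inj₂ (inj₁ refl)) (inj₁ refl) (inj₂ (inj₂ refl))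

    neighbour-across-bc : toℕ c ≢ suc (toℕ b) → ∃[ d ] AdjH E ℓ (b , d , c)
    neighbour-across-bc c≢1+b with inner-apex {b} {c} b<c c≢1+b ebc
    ... | d , b<d , d<c , ebd , edc =
      d , across (b , d , c) (face-intro {b} {d} {c} b<d d<c ebd edc ebc) (λ e → <⇒≢ a<b (cong proj₁ e))
                 (<⇒≢ b<c) (inj₂ (inj₁ refl)) (inj₂ (inj₂ refl)) (inj₁ refl) (inj₂ (inj₂ refl))

    neighbour-across-ac : ¬ (toℕ a ≡ 0 × suc (toℕ c) ≡ n) →
                          ∃[ d ] ((c < d × AdjH E ℓ (a , c , d)) ⊎ (d < a × AdjH E ℓ (d , a , c)))
    neighbour-across-ac not-closing with outer-apex {a} {c} a<c not-closing eac
    ... | d , inj₁ c<d , ead , edc =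
      d , inj₁ (c<d , across (a , c , d) (face-intro {a} {c} {d} a<c c<d eac (edge-sym edc) ead)
                             (λ e → <⇒≢ b<c (cong (proj₁ ∘ proj₂) e)) (<⇒≢ a<c)
                             (inj₁ refl) (inj₂ (inj₂ refl)) (inj₁ refl) (inj₂ (inj₁ refl)))
    ... | d , inj₂ d<a , ead , edc =
      d , inj₂ (d<a , across (d , a , c) (face-intro {d} {a} {c} d<a a<c (edge-sym ead) eac edc)
                             (λ e → <⇒≢ d<a (sym (cong proj₁ e))) (<⇒≢ a<c)
                             (inj₁ refl) (inj₂ (inj₂ refl)) (inj₂ (inj₁ refl)) (inj₂ (inj₂ refl)))

    module _ (deg1 : degH E ℓ ≡ 1) where
      private
        same : ∀ t t′ → AdjH E ℓ t → AdjH E ℓ t′ → t ≡ t′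
        same t t′ = leaf-neighbour-unique {ℓ} {t} {t′} deg1

      leaf-not-ab-bc : toℕ b ≢ suc (toℕ a) → toℕ c ≢ suc (toℕ b) → ⊥
      leaf-not-ab-bc b≢1+a c≢1+b with neighbour-across-ab b≢1+a | neighbour-across-bc c≢1+b
      ... | d , _ , ℓ~t | d′ , ℓ~t′ = <⇒≢ a<b (cong proj₁ (same (a , d , b) (b , d′ , c) ℓ~t ℓ~t′))

      leaf-not-ab-ac : toℕ b ≢ suc (toℕ a) → ¬ (toℕ a ≡ 0 × suc (toℕ c) ≡ n) → ⊥
      leaf-not-ab-ac b≢1+a not-closing with neighbour-across-ab b≢1+a | neighbour-across-ac not-closing
      ... | d , d<b , ℓ~t | d′ , inj₁ (_ , ℓ~t′) =
        <⇒≢ (ℕ.<-trans d<b b<c) (cong (proj₁ ∘ proj₂) (same (a , d , b) (a , c , d′) ℓ~t ℓ~t′))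
      ... | d , _ , ℓ~t | d′ , inj₂ (d′<a , ℓ~t′) =
        <⇒≢ d′<a (sym (cong proj₁ (same (a , d , b) (d′ , a , c) ℓ~t ℓ~t′)))

      leaf-not-bc-ac : toℕ c ≢ suc (toℕ b) → ¬ (toℕ a ≡ 0 × suc (toℕ c) ≡ n) → ⊥
      leaf-not-bc-ac c≢1+b not-closing with neighbour-across-bc c≢1+b | neighbour-across-ac not-closing
      ... | d , ℓ~t | d′ , inj₁ (_ , ℓ~t′) =
        <⇒≢ a<b (sym (cong proj₁ (same (b , d , c) (a , c , d′) ℓ~t ℓ~t′)))
      ... | d , ℓ~t | d′ , inj₂ (d′<a , ℓ~t′) =
        <⇒≢ (ℕ.<-trans d′<a a<b) (sym (cong proj₁ (same (b , d , c) (d′ , a , c) ℓ~t ℓ~t′)))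

      leaf-tip : ∃[ x ] EarTip ℓ x
      leaf-tip with toℕ b ℕ.≟ suc (toℕ a) | toℕ c ℕ.≟ suc (toℕ b) | (toℕ a ℕ.≟ 0) ×-dec (suc (toℕ c) ℕ.≟ n)
      ... | yes b≡1+a | yes c≡1+b | _                  = b , middle b≡1+a c≡1+b
      ... | no b≢1+a  | no c≢1+b  | _                  = ⊥-elim (leaf-not-ab-bc b≢1+a c≢1+b)
      ... | yes b≡1+a | no _      | yes (a≡0 , 1+c≡n) = a , first a≡0 (trans b≡1+a (cong suc a≡0)) 1+c≡n
      ... | yes _     | no c≢1+b  | no not-closing     = ⊥-elim (leaf-not-bc-ac c≢1+b not-closing)
      ... | no _      | yes c≡1+b | yes (a≡0 , 1+c≡n) = c , last a≡0 c≡1+b 1+c≡n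
      ... | no b≢1+a  | yes _     | no not-closing     = ⊥-elim (leaf-not-ab-ac b≢1+a not-closing)


module SerpentineLeaves {n} (E : Graph n) where
  open Data.Nat using (_<_)
  open WeakDual E

  HWalk-snoc : ∀ {s t u k} → HWalk E s t k → AdjH E t u → HWalk E s u (suc k)
  HWalk-snoc here           t~u = step t~u here
  HWalk-snoc (step s~s′ w) t~u = step s~s′ (HWalk-snoc w t~u)

  module Along {m} (P : HPath E m) where
    open HPath P

    -- The bound is irrelevant, so positions given by equal numbers are definitionally equal.
    at : (j : ℕ) → .(j < suc m) → Tri n
    at j j≤m = vtx (fromℕ< j≤m)

    at-vtx : ∀ i → at (toℕ i) (toℕ<n i) ≡ vtx i
    at-vtx i = cong vtx (fromℕ<-toℕ i (toℕ<n i))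

    at-injective : ∀ {j k} (p : j < suc m) (q : k < suc m) → at j p ≡ at k q → j ≡ k
    at-injective p q e = trans (sym (toℕ-fromℕ< p)) (trans (cong toℕ (distinct e)) (toℕ-fromℕ< q))

    at-adjacent : ∀ {j} (j<m : j < m) → AdjH E (at j (ℕ.m<n⇒m<1+n j<m)) (at (suc j) (s≤s j<m))
    at-adjacent {j} j<m = subst (λ t → AdjH E t (at (suc j) (s≤s j<m))) (cong vtx inject₁-i) (adjacent i)
      where
      i : Fin m
      i = fromℕ< j<m
      inject₁-i : inject₁ i ≡ fromℕ< (ℕ.m<n⇒m<1+n j<m)
      inject₁-i = toℕ-injective
        (trans (toℕ-inject₁ i) (trans (toℕ-fromℕ< j<m) (sym (toℕ-fromℕ< (ℕ.m<n⇒m<1+n j<m)))))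

    walk-to : ∀ j (j≤m : j < suc m) → HWalk E (vtx fzero) (at j j≤m) j
    walk-to zero    _       = here
    walk-to (suc j) 1+j≤m = HWalk-snoc (walk-to j (ℕ.m<n⇒m<1+n j<m)) (at-adjacent j<m)
      where
      j<m : j < m
      j<m = ℕ.≤-pred 1+j≤m

    walk-to-end : HWalk E (vtx fzero) (vtx (fromℕ m)) m
    walk-to-end =
      subst (λ t → HWalk E (vtx fzero) t m) (cong vtx (sym (Finₚ.fromℕ-def m))) (walk-to m ℕ.≤-refl)

  open Along

  module _ {m} (P P′ : HPath E m) (same-start : HPath.vtx P fzero ≡ HPath.vtx P′ fzero)
           (leaf : degH E (HPath.vtx P fzero) ≡ 1)
           (deg≤2 : ∀ j (j<m : j < m) → degH E (at P j (ℕ.m<n⇒m<1+n j<m)) ≤ 2)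
           where

    private
      agree₂ : ∀ j (j<m : j < m) → at P j (ℕ.m<n⇒m<1+n j<m) ≡ at P′ j (ℕ.m<n⇒m<1+n j<m)
                                 × at P (suc j) (s≤s j<m) ≡ at P′ (suc j) (s≤s j<m)
      agree₂ zero 0<m = same-start ,
        leaf-neighbour-unique {ℓ} {at P 1 (s≤s 0<m)} {at P′ 1 (s≤s 0<m)} leaf (at-adjacent P 0<m)
          (subst (λ s → AdjH E s (at P′ 1 (s≤s 0<m))) (sym same-start) (at-adjacent P′ 0<m))
        where
        ℓ : Tri n
        ℓ = HPath.vtx P fzero
      agree₂ (suc j) 1+j<m with agree₂ j (ℕ.<-trans (ℕ.n<1+n j) 1+j<m)
      ... | agree-j , agree-1+j = agree-1+j ,
        degree≤2-neighbour-unique {s} {r} {t} {t′} (deg≤2 (suc j) 1+j<m) s~r s~t s~t′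
          (λ r≡t → j≢2+j (at-injective P (ℕ.m<n⇒m<1+n j<m) (s≤s 1+j<m) r≡t))
          (λ r≡t′ → j≢2+j (at-injective P′ (ℕ.m<n⇒m<1+n j<m) (s≤s 1+j<m) (trans (sym agree-j) r≡t′)))
        where
        j<m : j < m
        j<m = ℕ.<-trans (ℕ.n<1+n j) 1+j<m
        j≢2+j : j ≢ suc (suc j)
        j≢2+j = ℕ.<⇒≢ (ℕ.m<n⇒m<1+n (ℕ.n<1+n j))
        s r t t′ : Tri n
        s = at P (suc j) (s≤s j<m)
        r = at P j (ℕ.m<n⇒m<1+n j<m)
        t = at P (suc (suc j)) (s≤s 1+j<m)
        t′ = at P′ (suc (suc j)) (s≤s 1+j<m)
        s~r : AdjH E s r
        s~r = adjacent-sym {r} {s} (at-adjacent P j<m)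
        s~t : AdjH E s t
        s~t = at-adjacent P 1+j<m
        s~t′ : AdjH E s t′
        s~t′ = subst (λ u → AdjH E u t′) (sym agree-1+j) (at-adjacent P′ 1+j<m)

      agree : ∀ j (j≤m : j < suc m) → at P j j≤m ≡ at P′ j j≤m
      agree zero    _     = same-start
      agree (suc j) 1+j≤m = proj₂ (agree₂ j (ℕ.≤-pred 1+j≤m))

    paths-from-leaf-agree : ∀ i → HPath.vtx P i ≡ HPath.vtx P′ i
    paths-from-leaf-agree i = trans (sym (at-vtx P i)) (trans (agree (toℕ i) (toℕ<n i)) (at-vtx P′ i))

  before-nearest-degree≤2 : ∀ {m} (P : HPath E m) →
    (∀ w k → Face E w → 2 < degH E w → HWalk E (HPath.vtx P fzero) w k → m ≤ k) →
    ∀ j (j<m : j < m) → degH E (at P j (ℕ.m<n⇒m<1+n j<m)) ≤ 2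
  before-nearest-degree≤2 P nearest j j<m = ℕ.≮⇒≥ λ 2<deg →
    ℕ.<⇒≱ j<m (nearest _ j (HPath.isFace P _) 2<deg (walk-to P j (ℕ.m<n⇒m<1+n j<m)))

  nearest-bound : ∀ {m m′} (P : HPath E m) (P′ : HPath E m′) → HPath.vtx P fzero ≡ HPath.vtx P′ fzero →
    (∀ w k → Face E w → 2 < degH E w → HWalk E (HPath.vtx P fzero) w k → m ≤ k) →
    2 < degH E (HPath.vtx P′ (fromℕ m′)) → m ≤ m′
  nearest-bound {m′ = m′} P P′ same-start nearest far′ = nearest _ m′ (HPath.isFace P′ _) far′
    (subst (λ s → HWalk E s (HPath.vtx P′ (fromℕ m′)) m′) (sym same-start) (walk-to-end P′))

  leaf-triangle : ∀ {S} → SerpentineLeaf E S → Tri n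
  leaf-triangle (_ , P , _) = HPath.vtx P fzero

  SerpentineLeaf-determined : ∀ {S S′} (L : SerpentineLeaf E S) (L′ : SerpentineLeaf E S′) →
                              leaf-triangle L ≡ leaf-triangle L′ → S ≐ₜ S′
  SerpentineLeaf-determined {S} {S′} (m , P , leaf , far , nearest , S⊆P , P⊆S)
                                     (m′ , P′ , _ , far′ , nearest′ , S′⊆P′ , P′⊆S′) same-start
    with ℕ.≤-antisym (nearest-bound P P′ same-start nearest far′)
                     (nearest-bound P′ P (sym same-start) nearest′ far)
  ... | refl = λ t → (λ t∈S → let i , e = S⊆P t t∈S in subst S′ (trans (sym (agree (inject₁ i))) e) (P′⊆S′ i))
                   , (λ t∈S′ → let i , e = S′⊆P′ t t∈S′ in subst S (trans (agree (inject₁ i)) e) (P⊆S i))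
    where
    agree : ∀ i → HPath.vtx P i ≡ HPath.vtx P′ i
    agree = paths-from-leaf-agree P P′ same-start leaf (before-nearest-degree≤2 P nearest)


module LeafTips {n} {E : Graph n} (mop : IsMOP E) where
  open LeafFaces mop
  open SerpentineLeaves E

  serpentine-leaf-tip : ∀ {S} (L : SerpentineLeaf E S) → ∃[ x ] (EarTip (leaf-triangle L) x × Ear E x)
  serpentine-leaf-tip (_ , P , leaf , _) with leaf-tip (HPath.isFace P fzero) leaf
  ... | x , tip = x , tip , EarTip⇒Ear (HPath.isFace P fzero) tip

  tip : ∀ {S} → SerpentineLeaf E S → Fin n
  tip L = proj₁ (serpentine-leaf-tip L)

  tip-injective : ∀ {S S′} (L : SerpentineLeaf E S) (L′ : SerpentineLeaf E S′) → tip L ≡ tip L′ → S ≐ₜ S′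
  tip-injective L L′ same-tip = SerpentineLeaf-determined L L′ (EarTip-injective tip-L tip-L′)
    where
    tip-L : EarTip (leaf-triangle L) (tip L)
    tip-L = proj₁ (proj₂ (serpentine-leaf-tip L))
    tip-L′ : EarTip (leaf-triangle L′) (tip L)
    tip-L′ = subst (EarTip (leaf-triangle L′)) (sym same-tip) (proj₁ (proj₂ (serpentine-leaf-tip L′)))

  serpentine-leaves≤2∣S∣ : ∀ {Ls} → All (SerpentineLeaf E) Ls → AllPairs (λ S S′ → ¬ (S ≐ₜ S′)) Ls →
                           ∀ S → ZeroForcingSet E S → length Ls ≤ 2 * ∣ S ∣
  serpentine-leaves≤2∣S∣ leaves distinct S zfs =
    subst (_≤ 2 * ∣ S ∣) (length-reduce tip leaves)
      (ZeroForcing.ears≤2∣S∣ E S (IsMOP.symmetric mop) (IsMOP.irreflexive mop) zfs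
        (AllPairs-reduce⁺ tip (λ L L′ S≉S′ same-tip → S≉S′ (tip-injective L L′ same-tip)) leaves distinct)
        (All-reduce⁺ tip (λ L → proj₂ (proj₂ (serpentine-leaf-tip L))) leaves))

corollary2p8 : ∀ {n : ℕ} (E : Graph n) → IsMOP E →
    (∃[ t ] SepTri E t) →
    ∀ (c' n₂' : ℕ) →
    HasCard _≐ᵥ_ (InH E) c' →
    HasCard _≐ₜ_ (LeafAdjH E) n₂' →
    ∀ (S : Subset n) → ZeroForcingSet E S →
    n₂' / 2 ∸ 2 * c' ≤ ∣ S ∣
corollary2p8 E mop _ c' n₂' _ (Ls , length≡n₂' , Ls-adjacent , distinct , _) S zfs = begin
  n₂' / 2 ∸ 2 * c'   ≤⟨ ℕ.m∸n≤m (n₂' / 2) (2 * c') ⟩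
  n₂' / 2            ≤⟨ /-monoˡ-≤ 2 n₂'≤∣S∣*2 ⟩
  ∣ S ∣ * 2 / 2      ≡⟨ m*n/n≡m ∣ S ∣ 2 ⟩
  ∣ S ∣              ∎
  where
  open ℕ.≤-Reasoning
  n₂'≤∣S∣*2 : n₂' ≤ ∣ S ∣ * 2
  n₂'≤∣S∣*2 = subst₂ _≤_ length≡n₂' (ℕ.*-comm 2 ∣ S ∣)
    (LeafTips.serpentine-leaves≤2∣S∣ mop (All.map proj₁ Ls-adjacent) distinct S zfs)
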